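{- Let $V$ be a vector space over $\mathbb{F}_2$ of dimension $2r$ with $r\geq 1$, equipped with a nondegenerate quadratic form $Q$. (i) If $Q$ is hyperbolic and $r\equiv 0$ or $1\pmod 4$, then $V$ has a symmetric basis. (ii) If $Q$ is elliptic and $r\equiv 2$ or $3\pmod 4$, then $V$ has a symmetric basis.
   Context: Associated bilinear form: $B(u,v)=Q(u+v)-Q(u)-Q(v)$; $Q$ nondegenerate means $B$ is. A basis $\{v_1,\ldots,v_d\}$ is symmetric if $Q(v_i)=0$ for all $i$ and $B(v_i,v_j)=1$ for all $i<j$. $Q$ is hyperbolic if $V$ has a basis $e_1,\ldots,e_r,f_1,\ldots,f_r$ with $Q(e_i)=Q(f_i)=0$ and $B(e_i,f_j)=\delta_{ij}$ (and $B(e_i,e_j)=B(f_i,f_j)=0$); $Q$ is elliptic if $V$ has a basis $e_1,\ldots,e_{r-1},f_1,\ldots,f_{r-1},x,y$ with $Q(e_i)=Q(f_i)=0$, $B(e_i,f_j)=\delta_{ij}$, $e_i,f_i$ orthogonal to $x,y$, $Q(x)=1$, $B(x,y)=1$, $Q(y)=\zeta$ where $X^2+X+\zeta$ is irreducible (over $\mathbb{F}_2$, $\zeta=1$). Every nondegenerate quadratic form on an even-dimensional space is of exactly one of these two types. -}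

module Defs where

open import Data.Bool using (Bool; true; false; _xor_; _∧_)
open import Data.Nat using (ℕ; _+_; _*_)
open import Data.Fin using (Fin; _<_)
open import Data.Vec using (Vec; []; _∷_; zipWith; map; replicate; lookup; tabulate; _++_)
open import Data.Product using (Σ; _×_; ∃; ∃-syntax)
open import Relation.Binary.PropositionalEquality using (_≡_; _≢_)

-- The field F₂ is modelled by Bool (false = 0, true = 1, xor = +, ∧ = ·).
-- An n-dimensional F₂-vector space is modelled by F₂ⁿ = Vec Bool n.
V : ℕ → Set
V n = Vec Bool n

0V : ∀ {n} → V n
0V = replicate _ false

infixl 6 _⊕_
_⊕_ : ∀ {n} → V n → V n → V n
_⊕_ = zipWith _xor_

infixl 7 _·_
_·_ : ∀ {n} → Bool → V n → V n
c · v = map (c ∧_) v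

lincomb : ∀ {n m} → Vec Bool m → Vec (V n) m → V n
lincomb [] [] = 0V
lincomb (c ∷ cs) (v ∷ vs) = c · v ⊕ lincomb cs vs

IsBasis : ∀ {n m} → Vec (V n) m → Set
IsBasis {n} {m} vs =
  (∀ (c : Vec Bool m) → lincomb c vs ≡ 0V → c ≡ replicate m false)
  × (∀ (w : V n) → ∃[ c ] lincomb c vs ≡ w)

-- associated bilinear form B(u,v) = Q(u+v) - Q(u) - Q(v)  (over F₂: + = - = xor)
Bf : ∀ {n} → (V n → Bool) → V n → V n → Bool
Bf Q u v = Q (u ⊕ v) xor Q u xor Q v

IsQuadraticForm : ∀ {n} → (V n → Bool) → Set
IsQuadraticForm {n} Q =
  (∀ (c : Bool) (v : V n) → Q (c · v) ≡ (c ∧ c) ∧ Q v)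
  × (∀ (u u' v : V n) → Bf Q (u ⊕ u') v ≡ Bf Q u v xor Bf Q u' v)
  × (∀ (u v v' : V n) → Bf Q u (v ⊕ v') ≡ Bf Q u v xor Bf Q u v')
  × (∀ (c : Bool) (u v : V n) → Bf Q (c · u) v ≡ c ∧ Bf Q u v)
  × (∀ (c : Bool) (u v : V n) → Bf Q u (c · v) ≡ c ∧ Bf Q u v)

IsNondegenerate : ∀ {n} → (V n → Bool) → Set
IsNondegenerate {n} Q = ∀ (u : V n) → (∀ (v : V n) → Bf Q u v ≡ false) → u ≡ 0V

data Delta {r : ℕ} : Fin r → Fin r → Bool → Set where
  δ-eq  : ∀ i → Delta i i true
  δ-neq : ∀ i j → i ≢ j → Delta i j false

HypPairs : ∀ {n} (s : ℕ) → (V n → Bool) → (Fin s → V n) → (Fin s → V n) → Set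
HypPairs s Q e f =
  (∀ i → Q (e i) ≡ false) × (∀ i → Q (f i) ≡ false)
  × (∀ i j → Delta i j (Bf Q (e i) (f j)))
  × (∀ i j → Bf Q (e i) (e j) ≡ false) × (∀ i j → Bf Q (f i) (f j) ≡ false)

IsHyperbolic : ∀ {n} (r : ℕ) → (V n → Bool) → Set
IsHyperbolic {n} r Q = Σ (Fin r → V n) λ e → Σ (Fin r → V n) λ f →
  IsBasis (tabulate e ++ tabulate f) × HypPairs r Q e f

-- Q is elliptic: basis e₁..e_{s}, f₁..f_{s}, x, y (s = r-1) with hyperbolic pairs
-- orthogonal to x, y, Q(x) = 1, B(x,y) = 1, Q(y) = ζ = 1 (over F₂)
IsElliptic : ∀ {n} (s : ℕ) → (V n → Bool) → Set
IsElliptic {n} s Q = Σ (Fin s → V n) λ e → Σ (Fin s → V n) λ f → Σ (V n) λ x → Σ (V n) λ y →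
  IsBasis (tabulate e ++ tabulate f ++ (x ∷ y ∷ [])) × HypPairs s Q e f
  × (∀ i → Bf Q (e i) x ≡ false) × (∀ i → Bf Q (e i) y ≡ false)
  × (∀ i → Bf Q (f i) x ≡ false) × (∀ i → Bf Q (f i) y ≡ false)
  × Q x ≡ true × Bf Q x y ≡ true × Q y ≡ true

HasSymmetricBasis : ∀ {n} → (V n → Bool) → Set
HasSymmetricBasis {n} Q = Σ (Vec (V n) n) λ vs →
  IsBasis vs
  × (∀ i → Q (lookup vs i) ≡ false)
  × (∀ i j → i < j → Bf Q (lookup vs i) (lookup vs j) ≡ true)

-- A symmetric basis is built one orthogonal plane at a time. Let (a , b) be a pair with
-- Q a = Q b = q and B(a , b) = 1, so that s = a + b has Q s = 1. If W is a family spanning the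
-- orthogonal complement of the pair, with Q = not q on W and B = 1 between distinct members, then
-- a, b and the translates w + s (w ∈ W) form such a family with Q = q: translating by s flips Q
-- and preserves B on the complement, and B(a , w + s) = B(b , w + s) = 1. Hyperbolic planes carry
-- pairs with q = 0 and the anisotropic plane E carries pairs with q = 1, so an orthogonal
-- decomposition into planes of alternating types H, E, H, E, … yields a symmetric basis. Since
-- H ⊥ H ≅ E ⊥ E, each block of four hyperbolic planes can be rewritten as H ⊥ E ⊥ H ⊥ E, and
-- under the congruences r ≡ 0, 1 (hyperbolic) and r ≡ 2, 3 (elliptic) mod 4 the at most three
-- remaining planes can be put in alternating order as well. Such a family is independent
-- because its Gram matrix J − I over F₂ is its own inverse in even dimension.

module Submission where

open import Defs
open import Data.Bool using (Bool; true; false; not; _xor_; _∧_)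
open import Data.Bool.Properties
  using (xor-assoc; xor-comm; xor-identityˡ; xor-identityʳ; xor-same; not-involutive;
         ∧-zeroʳ; ∧-identityʳ; ∧-distribʳ-xor)
open import Data.Fin using (Fin; zero; suc; _<_; #_)
open import Data.Fin.Properties using (∀-cons)
open import Data.Nat using (ℕ; zero; suc; _+_; _*_; _∸_; _≤_; _%_; s≤s)
open import Data.Nat.Properties using (*-distribˡ-+; +-comm; *-comm; +-suc)
open import Data.Nat.DivMod using (m*n%n≡0)
open import Data.Product using (Σ; _×_; _,_; proj₁; proj₂; ∃-syntax)
open import Data.Sum using (_⊎_; inj₁; inj₂)
open import Data.Unit using (⊤; tt)
open import Data.Vec using (Vec; []; _∷_; map; replicate; lookup; _++_)
open import Data.Vec.Properties using (zipWith-comm; zipWith-assoc; zipWith-identityˡ; zipWith-identityʳ)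
open import Data.Vec.Membership.Propositional using (_∈_)
open import Data.Vec.Membership.Propositional.Properties using (∈-lookup)
open import Data.Vec.Relation.Unary.Any using (here; there)
open import Data.Vec.Relation.Unary.All as All using (All; []; _∷_)
import Data.Vec.Relation.Unary.All.Properties as AllP
open import Function using (_∘_)
open import Relation.Nullary using (contradiction)
open import Relation.Binary.PropositionalEquality
open ≡-Reasoning

xor-cancelˡ : ∀ a b → (a xor b) xor a ≡ b
xor-cancelˡ false false = refl
xor-cancelˡ false true  = refl
xor-cancelˡ true  false = refl
xor-cancelˡ true  true  = refl

xor≡false⇒≡ : ∀ a b → a xor b ≡ false → b ≡ a
xor≡false⇒≡ false b eq = eq
xor≡false⇒≡ true false ()
xor≡false⇒≡ true true  _ = refl

parity : ∀ {k} → Vec Bool k → Bool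
parity []       = false
parity (c ∷ cs) = c xor parity cs

parity-replicate : ∀ k b → k % 2 ≡ 0 → parity (replicate k b) ≡ false
parity-replicate zero          b _    = refl
parity-replicate 1             b ()
parity-replicate (suc (suc k)) b even = begin
  b xor b xor parity (replicate k b)    ≡⟨ sym (xor-assoc b b _) ⟩
  (b xor b) xor parity (replicate k b)  ≡⟨ cong (_xor parity (replicate k b)) (xor-same b) ⟩
  parity (replicate k b)                ≡⟨ parity-replicate k b even ⟩
  false                                 ∎

All≡⇒replicate : ∀ {k} {b} {cs : Vec Bool k} → All (_≡ b) cs → cs ≡ replicate k b
All≡⇒replicate []          = refl
All≡⇒replicate (c≡ ∷ cs≡) = cong₂ _∷_ c≡ (All≡⇒replicate cs≡)

⊕-comm : ∀ {n} (x y : V n) → x ⊕ y ≡ y ⊕ x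
⊕-comm = zipWith-comm xor-comm

⊕-assoc : ∀ {n} (x y z : V n) → (x ⊕ y) ⊕ z ≡ x ⊕ (y ⊕ z)
⊕-assoc = zipWith-assoc xor-assoc

⊕-identityˡ : ∀ {n} (x : V n) → 0V ⊕ x ≡ x
⊕-identityˡ = zipWith-identityˡ xor-identityˡ

⊕-identityʳ : ∀ {n} (x : V n) → x ⊕ 0V ≡ x
⊕-identityʳ = zipWith-identityʳ xor-identityʳ

⊕-self : ∀ {n} (x : V n) → x ⊕ x ≡ 0V
⊕-self []       = refl
⊕-self (a ∷ x) = cong₂ _∷_ (xor-same a) (⊕-self x)

⊕-cancelʳ : ∀ {n} (x y : V n) → (x ⊕ y) ⊕ y ≡ x
⊕-cancelʳ x y = begin
  (x ⊕ y) ⊕ y  ≡⟨ ⊕-assoc x y y ⟩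
  x ⊕ (y ⊕ y)  ≡⟨ cong (x ⊕_) (⊕-self y) ⟩
  x ⊕ 0V       ≡⟨ ⊕-identityʳ x ⟩
  x            ∎

⊕-cancelˡ : ∀ {n} (x y : V n) → (x ⊕ y) ⊕ x ≡ y
⊕-cancelˡ x y = trans (cong (_⊕ x) (⊕-comm x y)) (⊕-cancelʳ y x)

⊕-interchange : ∀ {n} (w x y z : V n) → (w ⊕ x) ⊕ (y ⊕ z) ≡ (w ⊕ y) ⊕ (x ⊕ z)
⊕-interchange w x y z = begin
  (w ⊕ x) ⊕ (y ⊕ z)  ≡⟨ ⊕-assoc w x (y ⊕ z) ⟩
  w ⊕ (x ⊕ (y ⊕ z))  ≡⟨ cong (w ⊕_) (sym (⊕-assoc x y z)) ⟩
  w ⊕ ((x ⊕ y) ⊕ z)  ≡⟨ cong (λ v → w ⊕ (v ⊕ z)) (⊕-comm x y) ⟩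
  w ⊕ ((y ⊕ x) ⊕ z)  ≡⟨ cong (w ⊕_) (⊕-assoc y x z) ⟩
  w ⊕ (y ⊕ (x ⊕ z))  ≡⟨ sym (⊕-assoc w y (x ⊕ z)) ⟩
  (w ⊕ y) ⊕ (x ⊕ z)  ∎

·-zeroˡ : ∀ {n} (x : V n) → false · x ≡ 0V
·-zeroˡ []      = refl
·-zeroˡ (_ ∷ x) = cong (false ∷_) (·-zeroˡ x)

·-identityˡ : ∀ {n} (x : V n) → true · x ≡ x
·-identityˡ []      = refl
·-identityˡ (a ∷ x) = cong (a ∷_) (·-identityˡ x)

·-distribʳ-xor : ∀ {n} c d (x : V n) → (c xor d) · x ≡ c · x ⊕ d · x
·-distribʳ-xor c d []      = refl
·-distribʳ-xor c d (a ∷ x) = cong₂ _∷_ (∧-distribʳ-xor a c d) (·-distribʳ-xor c d x)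

lincomb-0 : ∀ {n k} (vs : Vec (V n) k) → lincomb 0V vs ≡ 0V
lincomb-0 []       = refl
lincomb-0 (v ∷ vs) = trans (cong₂ _⊕_ (·-zeroˡ v) (lincomb-0 vs)) (⊕-identityˡ 0V)

lincomb-⊕ : ∀ {n k} (c d : Vec Bool k) (vs : Vec (V n) k) →
            lincomb (c ⊕ d) vs ≡ lincomb c vs ⊕ lincomb d vs
lincomb-⊕ []       []       []       = sym (⊕-self 0V)
lincomb-⊕ (c ∷ cs) (d ∷ ds) (v ∷ vs) = begin
  (c xor d) · v ⊕ lincomb (cs ⊕ ds) vs               ≡⟨ cong₂ _⊕_ (·-distribʳ-xor c d v) (lincomb-⊕ cs ds vs) ⟩
  (c · v ⊕ d · v) ⊕ (lincomb cs vs ⊕ lincomb ds vs)  ≡⟨ ⊕-interchange _ _ _ _ ⟩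
  (c · v ⊕ lincomb cs vs) ⊕ (d · v ⊕ lincomb ds vs)  ∎

InSpan : ∀ {n k} → Vec (V n) k → V n → Set
InSpan vs x = ∃[ c ] lincomb c vs ≡ x

infix 4 _⊆span_
_⊆span_ : ∀ {n k l} → Vec (V n) k → Vec (V n) l → Set
xs ⊆span ws = All (InSpan ws) xs

module _ {n k} {ws : Vec (V n) k} where

  0∈span : InSpan ws 0V
  0∈span = 0V , lincomb-0 ws

  span-⊕ : ∀ {x y} → InSpan ws x → InSpan ws y → InSpan ws (x ⊕ y)
  span-⊕ (c , refl) (d , refl) = c ⊕ d , lincomb-⊕ c d ws

  span-· : ∀ {x} c → InSpan ws x → InSpan ws (c · x)
  span-· {x} true  x∈ = subst (InSpan ws) (sym (·-identityˡ x)) x∈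
  span-· {x} false _  = subst (InSpan ws) (sym (·-zeroˡ x)) 0∈span

  span-∷ : ∀ {x} v → InSpan ws x → InSpan (v ∷ ws) x
  span-∷ v (c , refl) = false ∷ c , trans (cong (_⊕ _) (·-zeroˡ v)) (⊕-identityˡ _)

∈⇒InSpan : ∀ {n k} {ws : Vec (V n) k} {x} → x ∈ ws → InSpan ws x
∈⇒InSpan {ws = w ∷ ws} (here refl) =
  true ∷ 0V , trans (cong₂ _⊕_ (·-identityˡ w) (lincomb-0 ws)) (⊕-identityʳ w)
∈⇒InSpan {ws = w ∷ ws} (there x∈) = span-∷ w (∈⇒InSpan x∈)

span-trans : ∀ {n k l} {xs : Vec (V n) k} {ws : Vec (V n) l} {y} →
             xs ⊆span ws → InSpan xs y → InSpan ws y
span-trans {xs = xs} {ws} xs⊆ (c , refl) = lincomb∈ xs⊆ c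
  where
  lincomb∈ : ∀ {k} {xs : Vec (V _) k} → xs ⊆span ws → ∀ c → InSpan ws (lincomb c xs)
  lincomb∈ []          []       = 0∈span
  lincomb∈ (x∈ ∷ xs⊆) (c ∷ cs) = span-⊕ (span-· c x∈) (lincomb∈ xs⊆ cs)

⊆span-trans : ∀ {n k l m} {xs : Vec (V n) k} {ys : Vec (V n) l} {zs : Vec (V n) m} →
              xs ⊆span ys → ys ⊆span zs → xs ⊆span zs
⊆span-trans xs⊆ ys⊆ = All.map (span-trans ys⊆) xs⊆

⊆span-∷ : ∀ {n k l} {xs : Vec (V n) k} {ws : Vec (V n) l} v → xs ⊆span ws → xs ⊆span v ∷ ws
⊆span-∷ v = All.map (span-∷ v)

⊆span-++ʳ : ∀ {n k l m} {xs : Vec (V n) k} {ws : Vec (V n) l} (vs : Vec (V n) m) →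
            xs ⊆span ws → xs ⊆span vs ++ ws
⊆span-++ʳ []       xs⊆ = xs⊆
⊆span-++ʳ (v ∷ vs) xs⊆ = ⊆span-∷ v (⊆span-++ʳ vs xs⊆)

⊆span-refl : ∀ {n k} (xs : Vec (V n) k) → xs ⊆span xs
⊆span-refl []       = []
⊆span-refl (x ∷ xs) = ∈⇒InSpan (here refl) ∷ ⊆span-∷ x (⊆span-refl xs)

⊆span-shift : ∀ {n k l} {xs : Vec (V n) k} {ws : Vec (V n) l} {s} →
              InSpan ws s → xs ⊆span ws → map (_⊕ s) xs ⊆span ws
⊆span-shift s∈ xs⊆ = AllP.map⁺ (All.map (λ x∈ → span-⊕ x∈ s∈) xs⊆)

shift-involutive : ∀ {n k} s (xs : Vec (V n) k) → map (_⊕ s) (map (_⊕ s) xs) ≡ xs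
shift-involutive s []       = refl
shift-involutive s (x ∷ xs) = cong₂ _∷_ (⊕-cancelʳ x s) (shift-involutive s xs)

sum∈span : ∀ {n k} (a b : V n) (ws : Vec (V n) k) → InSpan (a ∷ b ∷ ws) (a ⊕ b)
sum∈span a b ws = span-⊕ (∈⇒InSpan (here refl)) (∈⇒InSpan (there (here refl)))

lookup∈span : ∀ {n k} (xs : Vec (V n) k) i → InSpan xs (lookup xs i)
lookup∈span xs i = ∈⇒InSpan (∈-lookup i xs)

spans-via : ∀ {n k l} {B₀ : Vec (V n) k} {X : Vec (V n) l} → (∀ w → InSpan B₀ w) → All (_∈ X) B₀ →
            ∀ w → InSpan X w
spans-via B₀-spans B₀∈X w = span-trans (All.map ∈⇒InSpan B₀∈X) (B₀-spans w)

double : ℕ → ℕ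
double zero    = zero
double (suc p) = suc (suc (double p))

double-length : ∀ p t → double p + double t ≡ 2 * (t + p)
double-length p t = begin
  double p + double t  ≡⟨ cong₂ _+_ (double≡2* p) (double≡2* t) ⟩
  2 * p + 2 * t        ≡⟨ *-distribˡ-+ 2 p t ⟨
  2 * (p + t)          ≡⟨ cong (2 *_) (+-comm p t) ⟩
  2 * (t + p)          ∎
  where
  double≡2* : ∀ p → double p ≡ 2 * p
  double≡2* zero    = refl
  double≡2* (suc p) = cong suc (trans (cong suc (double≡2* p)) (sym (+-suc p (p + 0))))

2*m%2≡0 : ∀ m → (2 * m) % 2 ≡ 0
2*m%2≡0 m = trans (cong (_% 2) (*-comm 2 m)) (m*n%n≡0 m 2)

%4-pred : ∀ p {i} → suc p % 4 ≡ suc i → p % 4 ≡ i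
%4-pred 0 refl = refl
%4-pred 1 refl = refl
%4-pred 2 refl = refl
%4-pred 3 ()
%4-pred (suc (suc (suc (suc p)))) eq = %4-pred p eq

interleave : ∀ {n k} s → (Fin s → V n) → (Fin s → V n) → Vec (V n) k → Vec (V n) (double s + k)
interleave zero    e f T = T
interleave (suc s) e f T = e zero ∷ f zero ∷ interleave s (e ∘ suc) (f ∘ suc) T

module _ {n k} {T : Vec (V n) k} where

  ∈-interleaveˡ : ∀ {s e f} i → e i ∈ interleave s e f T
  ∈-interleaveˡ zero    = here refl
  ∈-interleaveˡ (suc i) = there (there (∈-interleaveˡ i))

  ∈-interleaveʳ : ∀ {s e f} i → f i ∈ interleave s e f T
  ∈-interleaveʳ zero    = there (here refl)
  ∈-interleaveʳ (suc i) = there (there (∈-interleaveʳ i))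

  ∈-interleave-tail : ∀ {s e f x} → x ∈ T → x ∈ interleave s e f T
  ∈-interleave-tail {zero}  x∈T = x∈T
  ∈-interleave-tail {suc s} x∈T = there (there (∈-interleave-tail x∈T))

  All-interleave : ∀ {P : V n → Set} {s e f} → (∀ i → P (e i)) → (∀ i → P (f i)) → All P T →
                   All P (interleave s e f T)
  All-interleave {s = zero}  Pe Pf PT = PT
  All-interleave {s = suc s} Pe Pf PT = Pe zero ∷ Pf zero ∷ All-interleave (Pe ∘ suc) (Pf ∘ suc) PT

Delta-true : ∀ {r} {i : Fin r} {b} → Delta i i b → b ≡ true
Delta-true (δ-eq _)        = refl
Delta-true (δ-neq _ _ i≢i) = contradiction refl i≢i

Delta-false : ∀ {r} {i j : Fin r} {b} → i ≢ j → Delta i j b → b ≡ false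
Delta-false i≢i (δ-eq _)     = contradiction refl i≢i
Delta-false _   (δ-neq _ _ _) = refl

Delta-suc : ∀ {r} {i j : Fin r} {b} → Delta (suc i) (suc j) b → Delta i j b
Delta-suc (δ-eq _)             = δ-eq _
Delta-suc (δ-neq _ _ si≢sj) = δ-neq _ _ (si≢sj ∘ cong suc)

module QuadraticSpace {n} (Q : V n → Bool) (qf : IsQuadraticForm Q) where

  B : V n → V n → Bool
  B = Bf Q

  Q-· : ∀ c v → Q (c · v) ≡ (c ∧ c) ∧ Q v
  Q-· = proj₁ qf

  B-⊕ʳ : ∀ u v w → B u (v ⊕ w) ≡ B u v xor B u w
  B-⊕ʳ = proj₁ (proj₂ (proj₂ qf))

  B-·ʳ : ∀ c u v → B u (c · v) ≡ c ∧ B u v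
  B-·ʳ = proj₂ (proj₂ (proj₂ (proj₂ qf)))

  B-sym : ∀ u v → B u v ≡ B v u
  B-sym u v = cong₂ _xor_ (cong Q (⊕-comm u v)) (xor-comm (Q u) (Q v))

  B-⊕ˡ : ∀ u v w → B (u ⊕ v) w ≡ B u w xor B v w
  B-⊕ˡ u v w = begin
    B (u ⊕ v) w        ≡⟨ B-sym (u ⊕ v) w ⟩
    B w (u ⊕ v)        ≡⟨ B-⊕ʳ w u v ⟩
    B w u xor B w v    ≡⟨ cong₂ _xor_ (B-sym w u) (B-sym w v) ⟩
    B u w xor B v w    ∎

  Q-0 : Q 0V ≡ false
  Q-0 = trans (cong Q (sym (·-zeroˡ 0V))) (Q-· false 0V)

  B-self : ∀ u → B u u ≡ false
  B-self u = begin
    Q (u ⊕ u) xor Q u xor Q u  ≡⟨ cong₂ _xor_ (trans (cong Q (⊕-self u)) Q-0) (xor-same (Q u)) ⟩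
    false                      ∎

  B-0ʳ : ∀ u → B u 0V ≡ false
  B-0ʳ u = trans (cong (B u) (sym (·-zeroˡ 0V))) (B-·ʳ false u 0V)

  Q-⊕ : ∀ u v → Q (u ⊕ v) ≡ Q u xor Q v xor B u v
  Q-⊕ u v = cancel (Q (u ⊕ v)) (Q u) (Q v)
    where
    cancel : ∀ x a b → x ≡ a xor b xor x xor a xor b
    cancel false false false = refl
    cancel false false true  = refl
    cancel false true  false = refl
    cancel false true  true  = refl
    cancel true  false false = refl
    cancel true  false true  = refl
    cancel true  true  false = refl
    cancel true  true  true  = refl

  infix 4 _⊥_ _⊥*_
  _⊥_ : V n → V n → Set
  u ⊥ v = B u v ≡ false

  _⊥*_ : ∀ {k} → V n → Vec (V n) k → Set
  u ⊥* ws = All (u ⊥_) ws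

  ⊥-sym : ∀ {u v} → u ⊥ v → v ⊥ u
  ⊥-sym {u} {v} u⊥v = trans (B-sym v u) u⊥v

  ⊥-⊕ʳ : ∀ {u v w} → u ⊥ v → u ⊥ w → u ⊥ v ⊕ w
  ⊥-⊕ʳ {u} {v} {w} u⊥v u⊥w = trans (B-⊕ʳ u v w) (cong₂ _xor_ u⊥v u⊥w)

  ⊥-⊕ˡ : ∀ {u v w} → u ⊥ w → v ⊥ w → u ⊕ v ⊥ w
  ⊥-⊕ˡ {u} {v} {w} u⊥w v⊥w = trans (B-⊕ˡ u v w) (cong₂ _xor_ u⊥w v⊥w)

  ⊥*-⊕ : ∀ {k u v} {ws : Vec (V n) k} → u ⊥* ws → v ⊥* ws → u ⊕ v ⊥* ws
  ⊥*-⊕ u⊥ws v⊥ws = All.map (λ (u⊥w , v⊥w) → ⊥-⊕ˡ u⊥w v⊥w) (All.zip (u⊥ws , v⊥ws))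

  B-lincomb-∷ : ∀ {k} u c v cs (vs : Vec (V n) k) →
                B u (lincomb (c ∷ cs) (v ∷ vs)) ≡ (c ∧ B u v) xor B u (lincomb cs vs)
  B-lincomb-∷ u c v cs vs = trans (B-⊕ʳ u (c · v) _) (cong (_xor _) (B-·ʳ c u v))

  ⊥-lincomb : ∀ {k u} {ws : Vec (V n) k} → u ⊥* ws → ∀ c → u ⊥ lincomb c ws
  ⊥-lincomb {u = u} []          []       = B-0ʳ u
  ⊥-lincomb {u = u} {w ∷ ws} (u⊥w ∷ u⊥ws) (c ∷ cs) = begin
    B u (lincomb (c ∷ cs) (w ∷ ws))        ≡⟨ B-lincomb-∷ u c w cs ws ⟩
    (c ∧ B u w) xor B u (lincomb cs ws)    ≡⟨ cong₂ (λ x y → (c ∧ x) xor y) u⊥w (⊥-lincomb u⊥ws cs) ⟩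
    (c ∧ false) xor false                  ≡⟨ cong (_xor false) (∧-zeroʳ c) ⟩
    false                                  ∎

  ⊥*-⊆span : ∀ {k l u} {ws : Vec (V n) k} {xs : Vec (V n) l} → u ⊥* ws → xs ⊆span ws → u ⊥* xs
  ⊥*-⊆span {u = u} u⊥ws = All.map λ { (c , refl) → ⊥-lincomb u⊥ws c }

  IsPair : Bool → V n → V n → Set
  IsPair q a b = Q a ≡ q × Q b ≡ q × B a b ≡ true

  pair-sum : ∀ {q a b} → IsPair q a b → Q (a ⊕ b) ≡ true
  pair-sum {q} {a} {b} (Qa , Qb , Bab) = begin
    Q (a ⊕ b)               ≡⟨ Q-⊕ a b ⟩
    Q a xor Q b xor B a b   ≡⟨ cong₂ _xor_ Qa (cong₂ _xor_ Qb Bab) ⟩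
    q xor q xor true        ≡⟨ sym (xor-assoc q q true) ⟩
    (q xor q) xor true      ≡⟨ cong (_xor true) (xor-same q) ⟩
    true                    ∎

  B-pair-sum : ∀ {q a b} → IsPair q a b → B a (a ⊕ b) ≡ true × B b (a ⊕ b) ≡ true
  B-pair-sum {a = a} {b} (_ , _ , Bab) =
    trans (B-⊕ʳ a a b) (cong₂ _xor_ (B-self a) Bab) ,
    trans (B-⊕ʳ b a b) (cong₂ _xor_ (trans (B-sym b a) Bab) (B-self b))

  Clique : ∀ {k} → Vec (V n) k → Set
  Clique []       = ⊤
  Clique (v ∷ vs) = All (λ w → B v w ≡ true) vs × Clique vs

  Clique-lookup : ∀ {k} {vs : Vec (V n) k} → Clique vs → ∀ i j → i < j → B (lookup vs i) (lookup vs j) ≡ true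
  Clique-lookup {vs = v ∷ vs} (v-vs , _)  zero    (suc j) _         = AllP.lookup⁺ v-vs j
  Clique-lookup {vs = v ∷ vs} (_ , clique) (suc i) (suc j) (s≤s i<j) = Clique-lookup clique i j i<j

  B-lincomb-ones : ∀ {k u} {ws : Vec (V n) k} → All (λ w → B u w ≡ true) ws → ∀ c → B u (lincomb c ws) ≡ parity c
  B-lincomb-ones {u = u} []                   []       = B-0ʳ u
  B-lincomb-ones {u = u} {w ∷ ws} (Buw ∷ Buws) (c ∷ cs) = begin
    B u (lincomb (c ∷ cs) (w ∷ ws))       ≡⟨ B-lincomb-∷ u c w cs ws ⟩
    (c ∧ B u w) xor B u (lincomb cs ws)   ≡⟨ cong₂ (λ x y → (c ∧ x) xor y) Buw (B-lincomb-ones Buws cs) ⟩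
    (c ∧ true) xor parity cs              ≡⟨ cong (_xor parity cs) (∧-identityʳ c) ⟩
    c xor parity cs                       ∎

  B-lincomb-clique : ∀ {k} {vs : Vec (V n) k} → Clique vs → ∀ c j →
                     B (lookup vs j) (lincomb c vs) ≡ parity c xor lookup c j
  B-lincomb-clique {vs = v ∷ vs} (v-vs , _) (c ∷ cs) zero = begin
    B v (lincomb (c ∷ cs) (v ∷ vs))       ≡⟨ B-lincomb-∷ v c v cs vs ⟩
    (c ∧ B v v) xor B v (lincomb cs vs)   ≡⟨ cong₂ (λ x y → (c ∧ x) xor y) (B-self v) (B-lincomb-ones v-vs cs) ⟩
    (c ∧ false) xor parity cs             ≡⟨ cong (_xor parity cs) (∧-zeroʳ c) ⟩
    parity cs                             ≡⟨ xor-cancelˡ c (parity cs) ⟨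
    (c xor parity cs) xor c               ∎
  B-lincomb-clique {vs = v ∷ vs} (v-vs , clique) (c ∷ cs) (suc j) = begin
    B w (lincomb (c ∷ cs) (v ∷ vs))       ≡⟨ B-lincomb-∷ w c v cs vs ⟩
    (c ∧ B w v) xor B w (lincomb cs vs)   ≡⟨ cong₂ (λ x y → (c ∧ x) xor y) Bwv (B-lincomb-clique clique cs j) ⟩
    (c ∧ true) xor parity cs xor lookup cs j   ≡⟨ cong (_xor _) (∧-identityʳ c) ⟩
    c xor parity cs xor lookup cs j       ≡⟨ xor-assoc c (parity cs) (lookup cs j) ⟨
    (c xor parity cs) xor lookup cs j     ∎
    where
    w = lookup vs j
    Bwv : B w v ≡ true
    Bwv = trans (B-sym w v) (AllP.lookup⁺ v-vs j)

  clique-independent : ∀ {k} {vs : Vec (V n) k} → k % 2 ≡ 0 → Clique vs →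
                       ∀ c → lincomb c vs ≡ 0V → c ≡ replicate k false
  clique-independent {k} {vs} even clique c c·vs≡0 = trans c≡σ (cong (replicate k) σ≡false)
    where
    σ = parity c
    c≡σ : c ≡ replicate k σ
    c≡σ = All≡⇒replicate (AllP.lookup⁻ λ j → xor≡false⇒≡ σ (lookup c j) (begin
      σ xor lookup c j            ≡⟨ B-lincomb-clique clique c j ⟨
      B (lookup vs j) (lincomb c vs)   ≡⟨ cong (B (lookup vs j)) c·vs≡0 ⟩
      B (lookup vs j) 0V          ≡⟨ B-0ʳ (lookup vs j) ⟩
      false                       ∎))
    σ≡false : σ ≡ false
    σ≡false = trans (cong parity c≡σ) (parity-replicate k σ even)

  Q-shift : ∀ {s w} → Q s ≡ true → w ⊥ s → Q (w ⊕ s) ≡ not (Q w)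
  Q-shift {s} {w} Qs w⊥s = begin
    Q (w ⊕ s)               ≡⟨ Q-⊕ w s ⟩
    Q w xor Q s xor B w s   ≡⟨ cong₂ (λ x y → Q w xor x xor y) Qs w⊥s ⟩
    Q w xor true            ≡⟨ xor-comm (Q w) true ⟩
    not (Q w)               ∎

  B-shift : ∀ {s w w'} → w ⊥ s → w' ⊥ s → B (w ⊕ s) (w' ⊕ s) ≡ B w w'
  B-shift {s} {w} {w'} w⊥s w'⊥s = begin
    B (w ⊕ s) (w' ⊕ s)                           ≡⟨ B-⊕ˡ w s (w' ⊕ s) ⟩
    B w (w' ⊕ s) xor B s (w' ⊕ s)                ≡⟨ cong₂ _xor_ (B-⊕ʳ w w' s) (B-⊕ʳ s w' s) ⟩
    (B w w' xor B w s) xor (B s w' xor B s s)    ≡⟨ cong₂ (λ x y → (B w w' xor x) xor y)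
                                                      w⊥s (cong₂ _xor_ (⊥-sym w'⊥s) (B-self s)) ⟩
    (B w w' xor false) xor false                 ≡⟨ xor-identityʳ _ ⟩
    B w w' xor false                             ≡⟨ xor-identityʳ _ ⟩
    B w w'                                       ∎

  B-shift-head : ∀ {s u w} → u ⊥ w → B u s ≡ true → B u (w ⊕ s) ≡ true
  B-shift-head {s} {u} {w} u⊥w Bus = trans (B-⊕ʳ u w s) (cong₂ _xor_ u⊥w Bus)

  Clique-shift : ∀ {k s} {ws : Vec (V n) k} → All (_⊥ s) ws → Clique ws → Clique (map (_⊕ s) ws)
  Clique-shift []            _              = tt
  Clique-shift (w⊥s ∷ ws⊥s) (w-ws , clique) =
    AllP.map⁺ (All.map (λ (w'⊥s , Bww') → trans (B-shift w⊥s w'⊥s) Bww') (All.zip (ws⊥s , w-ws))) ,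
    Clique-shift ws⊥s clique

  record Symmetrisation {k} (q : Bool) (X : Vec (V n) k) : Set where
    field
      family : Vec (V n) k
      values : All (λ w → Q w ≡ q) family
      clique : Clique family
      within : family ⊆span X
      covers : X ⊆span family

  symmetrise-[] : ∀ {q} → Symmetrisation q []
  symmetrise-[] = record { family = [] ; values = [] ; clique = tt ; within = [] ; covers = [] }

  symmetrise-≈ : ∀ {k q} {X Y : Vec (V n) k} → Symmetrisation q X → X ⊆span Y → Y ⊆span X → Symmetrisation q Y
  symmetrise-≈ S X⊆Y Y⊆X = record
    { family = family ; values = values ; clique = clique
    ; within = ⊆span-trans within X⊆Y ; covers = ⊆span-trans Y⊆X covers }
    where open Symmetrisation S

  symmetrise-∷ : ∀ {k q a b} {X : Vec (V n) k} → IsPair q a b → a ⊥* X → b ⊥* X →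
                 Symmetrisation (not q) X → Symmetrisation q (a ∷ b ∷ X)
  symmetrise-∷ {q = q} {a} {b} {X} ab@(Qa , Qb , Bab) a⊥X b⊥X S = record
    { family = a ∷ b ∷ W⁺
    ; values = Qa ∷ Qb ∷ AllP.map⁺ (All.map shifted-value (All.zip (values , W⊥s)))
    ; clique = (Bab ∷ shifted-ones a⊥W (proj₁ (B-pair-sum ab))) , shifted-ones b⊥W (proj₂ (B-pair-sum ab)) ,
               Clique-shift W⊥s clique
    ; within = ∈⇒InSpan (here refl) ∷ ∈⇒InSpan (there (here refl)) ∷
               ⊆span-shift (sum∈span a b X) (⊆span-∷ a (⊆span-∷ b within))
    ; covers = ∈⇒InSpan (here refl) ∷ ∈⇒InSpan (there (here refl)) ∷ ⊆span-trans covers W⊆W⁺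
    }
    where
    open Symmetrisation S
    s = a ⊕ b
    W⁺ = map (_⊕ s) family
    a⊥W = ⊥*-⊆span a⊥X within
    b⊥W = ⊥*-⊆span b⊥X within
    W⊥s : All (_⊥ s) family
    W⊥s = All.map (λ (a⊥w , b⊥w) → ⊥-⊕ʳ (⊥-sym a⊥w) (⊥-sym b⊥w)) (All.zip (a⊥W , b⊥W))
    shifted-value : ∀ {w} → Q w ≡ not q × w ⊥ s → Q (w ⊕ s) ≡ q
    shifted-value (Qw , w⊥s) = trans (Q-shift (pair-sum ab) w⊥s) (trans (cong not Qw) (not-involutive q))
    shifted-ones : ∀ {u} → u ⊥* family → B u s ≡ true → All (λ w → B u w ≡ true) W⁺
    shifted-ones u⊥W Bus = AllP.map⁺ (All.map (λ u⊥w → B-shift-head u⊥w Bus) u⊥W)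
    W⊆W⁺ : family ⊆span a ∷ b ∷ W⁺
    W⊆W⁺ = subst (_⊆span a ∷ b ∷ W⁺) (shift-involutive s family)
             (⊆span-shift (sum∈span a b W⁺) (⊆span-∷ a (⊆span-∷ b (⊆span-refl W⁺))))

  elliptic-pair : ∀ {e f z} → IsPair false e f → Q z ≡ true → e ⊥ z → f ⊥ z → IsPair true (e ⊕ f) (e ⊕ z)
  elliptic-pair {e} {f} {z} ef@(Qe , _ , Bef) Qz e⊥z f⊥z =
    pair-sum ef ,
    trans (Q-⊕ e z) (cong₂ _xor_ Qe (cong₂ _xor_ Qz e⊥z)) ,
    (begin
      B (e ⊕ f) (e ⊕ z)                            ≡⟨ B-⊕ˡ e f (e ⊕ z) ⟩
      B e (e ⊕ z) xor B f (e ⊕ z)                  ≡⟨ cong₂ _xor_ (B-⊕ʳ e e z) (B-⊕ʳ f e z) ⟩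
      (B e e xor B e z) xor (B f e xor B f z)      ≡⟨ cong₂ _xor_ (cong₂ _xor_ (B-self e) e⊥z)
                                                                  (cong₂ _xor_ (trans (B-sym f e) Bef) f⊥z) ⟩
      true                                         ∎)

  HyperbolicOver : ∀ {k} (p : ℕ) → (Vec (V n) k → Set) → Vec (V n) (double p + k) → Set
  HyperbolicOver zero    Base X           = Base X
  HyperbolicOver (suc p) Base (a ∷ b ∷ X) = IsPair false a b × a ⊥* X × b ⊥* X × HyperbolicOver p Base X

  HyperbolicOver-map : ∀ {k} p {Base Base' : Vec (V n) k → Set} → (∀ {Y} → Base Y → Base' Y) →
                       ∀ {X} → HyperbolicOver p Base X → HyperbolicOver p Base' X
  HyperbolicOver-map zero    f             base                 = f base
  HyperbolicOver-map (suc p) f {a ∷ b ∷ X} (ab , a⊥X , b⊥X , H) = ab , a⊥X , b⊥X , HyperbolicOver-map p f H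

  -- H ⊥ H ⊥ H ≅ E ⊥ H ⊥ E: with xᵢ = eᵢ ⊕ fᵢ, the pairs (x₁ , e₁ ⊕ x₃) and (x₃ , e₃ ⊕ x₁) are
  -- orthogonal elliptic pairs spanning the same space as the first and third hyperbolic pairs.
  symmetrise-H³ : ∀ {k} {X : Vec (V n) (double 3 + k)} →
                  HyperbolicOver 3 (Symmetrisation false) X → Symmetrisation true X
  symmetrise-H³ {X = e₁ ∷ f₁ ∷ e₂ ∷ f₂ ∷ e₃ ∷ f₃ ∷ Y}
    (p₁ , (e₁e₂ ∷ e₁f₂ ∷ e₁e₃ ∷ e₁f₃ ∷ e₁Y) , (f₁e₂ ∷ f₁f₂ ∷ f₁e₃ ∷ f₁f₃ ∷ f₁Y) ,
     p₂ , (e₂e₃ ∷ e₂f₃ ∷ e₂Y) , (f₂e₃ ∷ f₂f₃ ∷ f₂Y) ,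
     p₃ , e₃Y , f₃Y , S) =
    symmetrise-≈ S₁ X'⊆X X⊆X'
    where
    x₁ = e₁ ⊕ f₁
    x₃ = e₃ ⊕ f₃
    y₁ = e₁ ⊕ x₃
    y₃ = e₃ ⊕ x₁
    X  = e₁ ∷ f₁ ∷ e₂ ∷ f₂ ∷ e₃ ∷ f₃ ∷ Y
    X' = x₁ ∷ y₁ ∷ e₂ ∷ f₂ ∷ x₃ ∷ y₃ ∷ Y

    e₁⊥x₃ = ⊥-⊕ʳ e₁e₃ e₁f₃
    f₁⊥x₃ = ⊥-⊕ʳ f₁e₃ f₁f₃
    x₁⊥e₃ = ⊥-⊕ˡ e₁e₃ f₁e₃
    x₁⊥f₃ = ⊥-⊕ˡ e₁f₃ f₁f₃
    x₁⊥x₃ = ⊥-⊕ˡ e₁⊥x₃ f₁⊥x₃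
    x₁⊥e₂ = ⊥-⊕ˡ e₁e₂ f₁e₂
    x₁⊥f₂ = ⊥-⊕ˡ e₁f₂ f₁f₂
    e₂⊥x₃ = ⊥-⊕ʳ e₂e₃ e₂f₃
    f₂⊥x₃ = ⊥-⊕ʳ f₂e₃ f₂f₃
    x₁⊥Y  = ⊥*-⊕ e₁Y f₁Y
    x₃⊥Y  = ⊥*-⊕ e₃Y f₃Y

    y₁⊥y₃ : y₁ ⊥ y₃
    y₁⊥y₃ = begin
      B (e₁ ⊕ x₃) (e₃ ⊕ x₁)                              ≡⟨ B-⊕ˡ e₁ x₃ y₃ ⟩
      B e₁ (e₃ ⊕ x₁) xor B x₃ (e₃ ⊕ x₁)                  ≡⟨ cong₂ _xor_ (B-⊕ʳ e₁ e₃ x₁) (B-⊕ʳ x₃ e₃ x₁) ⟩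
      (B e₁ e₃ xor B e₁ x₁) xor (B x₃ e₃ xor B x₃ x₁)    ≡⟨ cong₂ _xor_
                                                            (cong₂ _xor_ e₁e₃ (proj₁ (B-pair-sum p₁)))
                                                            (cong₂ _xor_ (trans (B-sym x₃ e₃) (proj₁ (B-pair-sum p₃)))
                                                                         (⊥-sym x₁⊥x₃)) ⟩
      false                                              ∎

    S₃ : Symmetrisation true (x₃ ∷ y₃ ∷ Y)
    S₃ = symmetrise-∷ (elliptic-pair p₃ (pair-sum p₁) (⊥-sym x₁⊥e₃) (⊥-sym x₁⊥f₃)) x₃⊥Y (⊥*-⊕ e₃Y x₁⊥Y) S

    S₂ : Symmetrisation false (e₂ ∷ f₂ ∷ x₃ ∷ y₃ ∷ Y)
    S₂ = symmetrise-∷ p₂ (e₂⊥x₃ ∷ ⊥-⊕ʳ e₂e₃ (⊥-sym x₁⊥e₂) ∷ e₂Y) (f₂⊥x₃ ∷ ⊥-⊕ʳ f₂e₃ (⊥-sym x₁⊥f₂) ∷ f₂Y) S₃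

    S₁ : Symmetrisation true X'
    S₁ = symmetrise-∷ (elliptic-pair p₁ (pair-sum p₃) e₁⊥x₃ f₁⊥x₃)
           (x₁⊥e₂ ∷ x₁⊥f₂ ∷ x₁⊥x₃ ∷ ⊥-⊕ʳ x₁⊥e₃ (B-self x₁) ∷ x₁⊥Y)
           (⊥-⊕ˡ e₁e₂ (⊥-sym e₂⊥x₃) ∷ ⊥-⊕ˡ e₁f₂ (⊥-sym f₂⊥x₃) ∷ ⊥-⊕ˡ e₁⊥x₃ (B-self x₃) ∷ y₁⊥y₃ ∷ ⊥*-⊕ e₁Y x₃⊥Y)
           S₂

    X'⊆X : X' ⊆span X
    X'⊆X = x₁∈ ∷ span-⊕ (lookup∈span X (# 0)) x₃∈ ∷ lookup∈span X (# 2) ∷ lookup∈span X (# 3) ∷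
           x₃∈ ∷ span-⊕ (lookup∈span X (# 4)) x₁∈ ∷ ⊆span-++ʳ (e₁ ∷ f₁ ∷ e₂ ∷ f₂ ∷ e₃ ∷ f₃ ∷ []) (⊆span-refl Y)
      where
      x₁∈ = span-⊕ (lookup∈span X (# 0)) (lookup∈span X (# 1))
      x₃∈ = span-⊕ (lookup∈span X (# 4)) (lookup∈span X (# 5))

    X⊆X' : X ⊆span X'
    X⊆X' = e₁∈ ∷ subst (InSpan X') (⊕-cancelˡ e₁ f₁) (span-⊕ (lookup∈span X' (# 0)) e₁∈) ∷
           lookup∈span X' (# 2) ∷ lookup∈span X' (# 3) ∷
           e₃∈ ∷ subst (InSpan X') (⊕-cancelˡ e₃ f₃) (span-⊕ (lookup∈span X' (# 4)) e₃∈) ∷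
           ⊆span-++ʳ (x₁ ∷ y₁ ∷ e₂ ∷ f₂ ∷ x₃ ∷ y₃ ∷ []) (⊆span-refl Y)
      where
      e₁∈ = subst (InSpan X') (⊕-cancelʳ e₁ x₃) (span-⊕ (lookup∈span X' (# 1)) (lookup∈span X' (# 4)))
      e₃∈ = subst (InSpan X') (⊕-cancelʳ e₃ x₁) (span-⊕ (lookup∈span X' (# 5)) (lookup∈span X' (# 0)))

  symmetrise-hyperbolic : ∀ {k} p → p % 4 ≡ 0 → {X : Vec (V n) (double p + k)} →
                          HyperbolicOver p (Symmetrisation false) X → Symmetrisation false X
  symmetrise-hyperbolic zero _  S = S
  symmetrise-hyperbolic 1    () _
  symmetrise-hyperbolic 2    () _
  symmetrise-hyperbolic 3    () _
  symmetrise-hyperbolic (suc (suc (suc (suc p)))) p%4 {a ∷ b ∷ X@(_ ∷ _ ∷ _ ∷ _ ∷ _ ∷ _ ∷ _)}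
                        (ab , a⊥X , b⊥X , H) =
    symmetrise-∷ ab a⊥X b⊥X
      (symmetrise-H³ (HyperbolicOver-map 3 {HyperbolicOver p (Symmetrisation false)}
                                           (symmetrise-hyperbolic p p%4) {X} H))

  module HyperbolicPairs {s e f} (H : HypPairs s Q e f) where

    pair : ∀ i → IsPair false (e i) (f i)
    pair i = proj₁ H i , proj₁ (proj₂ H) i , Delta-true (proj₁ (proj₂ (proj₂ H)) i i)

    e⊥e : ∀ i j → e i ⊥ e j
    e⊥e = proj₁ (proj₂ (proj₂ (proj₂ H)))

    f⊥f : ∀ i j → f i ⊥ f j
    f⊥f = proj₂ (proj₂ (proj₂ (proj₂ H)))

    e⊥f : ∀ i j → i ≢ j → e i ⊥ f j
    e⊥f i j i≢j = Delta-false i≢j (proj₁ (proj₂ (proj₂ H)) i j)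

    f⊥e : ∀ i j → i ≢ j → f i ⊥ e j
    f⊥e i j i≢j = ⊥-sym (e⊥f j i (i≢j ∘ sym))

  HypPairs-suc : ∀ {s} e f → HypPairs (suc s) Q e f → HypPairs s Q (e ∘ suc) (f ∘ suc)
  HypPairs-suc e f (Qe , Qf , Bef , Bee , Bff) =
    Qe ∘ suc , Qf ∘ suc , (λ i j → Delta-suc (Bef (suc i) (suc j))) , (λ i j → Bee (suc i) (suc j)) ,
    (λ i j → Bff (suc i) (suc j))

  HypPairs⇒HyperbolicOver : ∀ {k s e f} {T : Vec (V n) k} → HypPairs s Q e f →
                            (∀ i → e i ⊥* T) → (∀ i → f i ⊥* T) → Symmetrisation false T →
                            HyperbolicOver s (Symmetrisation false) (interleave s e f T)
  HypPairs⇒HyperbolicOver {s = zero}  _ _   _   S = S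
  HypPairs⇒HyperbolicOver {s = suc s} {e} {f} H e⊥T f⊥T S =
    pair zero ,
    All-interleave (e⊥e zero ∘ suc) (λ i → e⊥f zero (suc i) (λ ())) (e⊥T zero) ,
    All-interleave (λ i → f⊥e zero (suc i) (λ ())) (f⊥f zero ∘ suc) (f⊥T zero) ,
    HypPairs⇒HyperbolicOver (HypPairs-suc e f H) (e⊥T ∘ suc) (f⊥T ∘ suc) S
    where open HyperbolicPairs H

  SymmetricBasis : ℕ → Set
  SymmetricBasis k = Σ (Vec (V n) k) λ vs →
    IsBasis vs × (∀ i → Q (lookup vs i) ≡ false) × (∀ i j → i < j → Bf Q (lookup vs i) (lookup vs j) ≡ true)

  Symmetrisation⇒SymmetricBasis : ∀ {k} {X : Vec (V n) k} → k % 2 ≡ 0 → (∀ w → InSpan X w) →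
                                  Symmetrisation false X → SymmetricBasis k
  Symmetrisation⇒SymmetricBasis even X-spans S =
    family , (clique-independent even clique , λ w → span-trans covers (X-spans w)) ,
    AllP.lookup⁺ values , Clique-lookup clique
    where open Symmetrisation S

  HyperbolicOver⇒SymmetricBasis : ∀ p t (X : Vec (V n) (double p + double t)) → p % 4 ≡ 0 →
                                  HyperbolicOver p (Symmetrisation false) X → (∀ w → InSpan X w) →
                                  SymmetricBasis (2 * (t + p))
  HyperbolicOver⇒SymmetricBasis p t X p%4 H X-spans =
    subst SymmetricBasis (double-length p t)
      (Symmetrisation⇒SymmetricBasis even X-spans (symmetrise-hyperbolic p p%4 H))
    where
    even = subst (λ m → m % 2 ≡ 0) (sym (double-length p t)) (2*m%2≡0 (t + p))

  hyperbolic⇒symmetric : ∀ r → IsHyperbolic r Q → r % 4 ≡ 0 ⊎ r % 4 ≡ 1 → SymmetricBasis (2 * r)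
  hyperbolic⇒symmetric r (e , f , (_ , spans) , H) (inj₁ r%4) =
    HyperbolicOver⇒SymmetricBasis r 0 (interleave r e f []) r%4
      (HypPairs⇒HyperbolicOver H (λ _ → []) (λ _ → []) symmetrise-[])
      (spans-via spans (AllP.++⁺ (AllP.tabulate⁺ (∈-interleaveˡ {s = r} {e} {f}))
                                 (AllP.tabulate⁺ (∈-interleaveʳ {s = r} {e} {f}))))
  hyperbolic⇒symmetric zero    _                            (inj₂ ())
  hyperbolic⇒symmetric (suc s) (e , f , (_ , spans) , H) (inj₂ r%4) =
    HyperbolicOver⇒SymmetricBasis s 1 X (%4-pred s r%4)
      (HypPairs⇒HyperbolicOver (HypPairs-suc e f H)
        (λ i → e⊥e (suc i) zero ∷ e⊥f (suc i) zero (λ ()) ∷ [])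
        (λ i → f⊥e (suc i) zero (λ ()) ∷ f⊥f (suc i) zero ∷ [])
        (symmetrise-∷ (pair zero) [] [] symmetrise-[]))
      (spans-via spans (AllP.++⁺ (AllP.tabulate⁺ e∈X) (AllP.tabulate⁺ f∈X)))
    where
    open HyperbolicPairs H
    X = interleave s (e ∘ suc) (f ∘ suc) (e zero ∷ f zero ∷ [])
    e∈X : ∀ i → e i ∈ X
    e∈X = ∀-cons (∈-interleave-tail (here refl)) ∈-interleaveˡ
    f∈X : ∀ i → f i ∈ X
    f∈X = ∀-cons (∈-interleave-tail (there (here refl))) ∈-interleaveʳ

  elliptic⇒symmetric : ∀ s → IsElliptic s Q → suc s % 4 ≡ 2 ⊎ suc s % 4 ≡ 3 → SymmetricBasis (2 * suc s)
  elliptic⇒symmetric zero _ (inj₁ ())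
  elliptic⇒symmetric zero _ (inj₂ ())
  elliptic⇒symmetric (suc s) (e , f , x , y , (_ , spans) , H , ex , ey , fx , fy , Qx , Bxy , Qy) (inj₁ r%4) =
    HyperbolicOver⇒SymmetricBasis s 2 X (%4-pred s (%4-pred (suc s) r%4))
      (HypPairs⇒HyperbolicOver (HypPairs-suc e f H)
        (λ i → e⊥e (suc i) zero ∷ e⊥f (suc i) zero (λ ()) ∷ ex (suc i) ∷ ey (suc i) ∷ [])
        (λ i → f⊥e (suc i) zero (λ ()) ∷ f⊥f (suc i) zero ∷ fx (suc i) ∷ fy (suc i) ∷ [])
        (symmetrise-∷ (pair zero) (ex zero ∷ ey zero ∷ []) (fx zero ∷ fy zero ∷ [])
          (symmetrise-∷ (Qx , Qy , Bxy) [] [] symmetrise-[])))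
      (spans-via spans (AllP.++⁺ (AllP.tabulate⁺ e∈X) (AllP.++⁺ (AllP.tabulate⁺ f∈X) (x∈X ∷ y∈X ∷ []))))
    where
    open HyperbolicPairs H
    X = interleave s (e ∘ suc) (f ∘ suc) (e zero ∷ f zero ∷ x ∷ y ∷ [])
    x∈X = ∈-interleave-tail {s = s} (there (there (here refl)))
    y∈X = ∈-interleave-tail {s = s} (there (there (there (here refl))))
    e∈X : ∀ i → e i ∈ X
    e∈X = ∀-cons (∈-interleave-tail (here refl)) ∈-interleaveˡ
    f∈X : ∀ i → f i ∈ X
    f∈X = ∀-cons (∈-interleave-tail (there (here refl))) ∈-interleaveʳ
  elliptic⇒symmetric (suc zero) _ (inj₂ ())
  elliptic⇒symmetric (suc (suc s)) (e , f , x , y , (_ , spans) , H , ex , ey , fx , fy , Qx , Bxy , Qy) (inj₂ r%4) =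
    HyperbolicOver⇒SymmetricBasis s 3 X (%4-pred s (%4-pred (suc s) (%4-pred (suc (suc s)) r%4)))
      (HypPairs⇒HyperbolicOver (HypPairs-suc (e ∘ suc) (f ∘ suc) (HypPairs-suc e f H))
        (λ i → e⊥e (2+ i) zero ∷ e⊥f (2+ i) zero (λ ()) ∷ ex (2+ i) ∷ ey (2+ i) ∷
               e⊥e (2+ i) (suc zero) ∷ e⊥f (2+ i) (suc zero) (λ ()) ∷ [])
        (λ i → f⊥e (2+ i) zero (λ ()) ∷ f⊥f (2+ i) zero ∷ fx (2+ i) ∷ fy (2+ i) ∷
               f⊥e (2+ i) (suc zero) (λ ()) ∷ f⊥f (2+ i) (suc zero) ∷ [])
        (symmetrise-∷ (pair zero)
          (ex zero ∷ ey zero ∷ e⊥e zero (suc zero) ∷ e⊥f zero (suc zero) (λ ()) ∷ [])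
          (fx zero ∷ fy zero ∷ f⊥e zero (suc zero) (λ ()) ∷ f⊥f zero (suc zero) ∷ [])
          (symmetrise-∷ (Qx , Qy , Bxy)
            (⊥-sym (ex (suc zero)) ∷ ⊥-sym (fx (suc zero)) ∷ [])
            (⊥-sym (ey (suc zero)) ∷ ⊥-sym (fy (suc zero)) ∷ [])
            (symmetrise-∷ (pair (suc zero)) [] [] symmetrise-[]))))
      (spans-via spans (AllP.++⁺ (AllP.tabulate⁺ e∈X) (AllP.++⁺ (AllP.tabulate⁺ f∈X) (x∈X ∷ y∈X ∷ []))))
    where
    open HyperbolicPairs H
    2+ : Fin s → Fin (suc (suc s))
    2+ i = suc (suc i)
    X = interleave s (e ∘ 2+) (f ∘ 2+) (e zero ∷ f zero ∷ x ∷ y ∷ e (suc zero) ∷ f (suc zero) ∷ [])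
    x∈X = ∈-interleave-tail {s = s} (there (there (here refl)))
    y∈X = ∈-interleave-tail {s = s} (there (there (there (here refl))))
    e∈X : ∀ i → e i ∈ X
    e∈X = ∀-cons (∈-interleave-tail (here refl))
            (∀-cons (∈-interleave-tail (there (there (there (there (here refl)))))) ∈-interleaveˡ)
    f∈X : ∀ i → f i ∈ X
    f∈X = ∀-cons (∈-interleave-tail (there (here refl)))
            (∀-cons (∈-interleave-tail (there (there (there (there (there (here refl))))))) ∈-interleaveʳ)

lemma3p3 : (r : ℕ) → 1 ≤ r → (Q : V (2 * r) → Bool) → IsQuadraticForm Q → IsNondegenerate Q →
    ((IsHyperbolic r Q × (r % 4 ≡ 0 ⊎ r % 4 ≡ 1)) → HasSymmetricBasis Q)
    × ((IsElliptic (r ∸ 1) Q × (r % 4 ≡ 2 ⊎ r % 4 ≡ 3)) → HasSymmetricBasis Q)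
lemma3p3 zero    ()  _ _  _
lemma3p3 (suc s) _  Q qf _ =
  (λ (H , r%4) → hyperbolic⇒symmetric (suc s) H r%4) ,
  (λ (E , r%4) → elliptic⇒symmetric s E r%4)
  where open QuadraticSpace Q qf
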